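{- Let $G$ be a graph and $v$ a vertex of $G$. Then $G$ is a nut graph if and only if its Fowler Construction $F(G,v)$ is a nut graph.
   Context: All graphs are finite and simple. For a graph $G$ with 0--1 adjacency matrix $\mathbf{A}(G)$, the nullity is the multiplicity of $0$ as an eigenvalue of $\mathbf{A}(G)$. A vertex is a core vertex if it corresponds to a nonzero entry of some vector in $\ker \mathbf{A}(G)$; a core graph is a singular graph all of whose vertices are core vertices; a nut graph is a core graph of nullity one. Fowler Construction: let $v$ have degree $\rho$ with neighbours $u_1,\dots,u_\rho$. The graph $F(G,v)$ is obtained from $G$ by adding $2\rho$ new vertices $p_1,\dots,p_\rho,q_1,\dots,q_\rho$; for each $i$, deleting the edge $vu_i$ and adding edges $vq_i$ and $p_iu_i$; and finally adding the edges $p_iq_j$ for all $i,j\in\{1,\dots,\rho\}$ with $i\neq j$.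
   Formalization: Vectors in the kernels of $\mathbf{A}(G)$ and of the adjacency matrix of $F(G,v)$ have rational entries rather than real ones. -}

module Defs where

open import Data.Nat using (ℕ; zero; suc; _+_)
open import Data.Fin using (Fin; zero; suc; splitAt; _≟_)
open import Data.Bool using (Bool; true; false; _∧_; not; if_then_else_)
open import Data.Sum using (_⊎_; inj₁; inj₂)
open import Data.Product using (Σ; ∃; _×_; _,_)
open import Data.Rational using (ℚ; 0ℚ; 1ℚ) renaming (_+_ to _+ℚ_; _*_ to _*ℚ_)
open import Relation.Binary.PropositionalEquality using (_≡_; _≢_)
open import Relation.Nullary.Decidable using (⌊_⌋)
open import Function.Definitions using (Injective)

Adj : ℕ → Set
Adj n = Fin n → Fin n → Bool

record Graph (n : ℕ) : Set where
  field
    adj    : Adj n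
    sym    : ∀ x y → adj x y ≡ adj y x
    irrefl : ∀ x → adj x x ≡ false
open Graph public

sumFin : ∀ n → (Fin n → ℚ) → ℚ
sumFin zero    f = 0ℚ
sumFin (suc n) f = f zero +ℚ sumFin n (λ i → f (suc i))

entry : Bool → ℚ
entry b = if b then 1ℚ else 0ℚ

InKernel : ∀ {n} → Adj n → (Fin n → ℚ) → Set
InKernel {n} A x = ∀ i → sumFin n (λ j → entry (A i j) *ℚ x j) ≡ 0ℚ

NonZeroVec : ∀ {n} → (Fin n → ℚ) → Set
NonZeroVec {n} x = Σ (Fin n) λ i → x i ≢ 0ℚ

Singular : ∀ {n} → Adj n → Set
Singular A = Σ _ λ x → InKernel A x × NonZeroVec x

NullityOne : ∀ {n} → Adj n → Set
NullityOne {n} A =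
  Σ (Fin n → ℚ) λ x → InKernel A x × NonZeroVec x ×
    (∀ y → InKernel A y → Σ ℚ λ c → ∀ j → y j ≡ c *ℚ x j)

IsCoreVertex : ∀ {n} → Adj n → Fin n → Set
IsCoreVertex A i = Σ _ λ x → InKernel A x × x i ≢ 0ℚ

IsCoreGraph : ∀ {n} → Adj n → Set
IsCoreGraph A = Singular A × (∀ i → IsCoreVertex A i)

IsNut : ∀ {n} → Adj n → Set
IsNut A = IsCoreGraph A × NullityOne A

IsNeighbourEnum : ∀ {n ρ} → Graph n → Fin n → (Fin ρ → Fin n) → Set
IsNeighbourEnum {n} {ρ} G v u =
  Injective _≡_ _≡_ u × (∀ w → adj G v w ≡ true → Σ (Fin ρ) λ i → u i ≡ w)
                      × (∀ i → adj G v (u i) ≡ true)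

-- Fowler construction on vertex set Fin n ⊎ (Fin ρ ⊎ Fin ρ):
-- inj₁ x = old vertex x, inj₂ (inj₁ i) = p_i, inj₂ (inj₂ i) = q_i.
-- Old–old edges: edges of G not incident to v (all edges v u_i are deleted,
-- and these are exactly the edges at v).
fowlerAdj⊎ : ∀ {n ρ} → Graph n → Fin n → (Fin ρ → Fin n)
           → Fin n ⊎ (Fin ρ ⊎ Fin ρ) → Fin n ⊎ (Fin ρ ⊎ Fin ρ) → Bool
fowlerAdj⊎ G v u (inj₁ x) (inj₁ y) = adj G x y ∧ not ⌊ x ≟ v ⌋ ∧ not ⌊ y ≟ v ⌋
fowlerAdj⊎ G v u (inj₁ x) (inj₂ (inj₁ i)) = ⌊ x ≟ u i ⌋
fowlerAdj⊎ G v u (inj₁ x) (inj₂ (inj₂ i)) = ⌊ x ≟ v ⌋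
fowlerAdj⊎ G v u (inj₂ (inj₁ i)) (inj₁ y) = ⌊ y ≟ u i ⌋
fowlerAdj⊎ G v u (inj₂ (inj₂ i)) (inj₁ y) = ⌊ y ≟ v ⌋
fowlerAdj⊎ G v u (inj₂ (inj₁ i)) (inj₂ (inj₁ j)) = false
fowlerAdj⊎ G v u (inj₂ (inj₂ i)) (inj₂ (inj₂ j)) = false
fowlerAdj⊎ G v u (inj₂ (inj₁ i)) (inj₂ (inj₂ j)) = not ⌊ i ≟ j ⌋
fowlerAdj⊎ G v u (inj₂ (inj₂ i)) (inj₂ (inj₁ j)) = not ⌊ i ≟ j ⌋

split3 : ∀ n ρ → Fin (n + (ρ + ρ)) → Fin n ⊎ (Fin ρ ⊎ Fin ρ)
split3 n ρ k with splitAt n k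
... | inj₁ x = inj₁ x
... | inj₂ y = inj₂ (splitAt ρ y)

fowler : ∀ {n ρ} → Graph n → Fin n → (Fin ρ → Fin n) → Adj (n + (ρ + ρ))
fowler {n} {ρ} G v u a b = fowlerAdj⊎ G v u (split3 n ρ a) (split3 n ρ b)

-- Write a vector on F(G,v) as blocks (y, p, q) on the old vertices, the
-- p-vertices and the q-vertices.  Its kernel equations say exactly that
-- q_i = y(u_i), that all p_i equal one value X = Σ p + y(v), and that the
-- vector φ = "y with y(v) replaced by X" lies in ker A(G).  Conversely a
-- kernel vector x of G yields the kernel vector ψ(x) of F(G,v) with blocks
-- y = "x with x(v) replaced by x(v) - ρ·x(v)", p = x(v), q_i = x(u_i).
-- The maps φ and ψ are mutually inverse homogeneous maps between the two
-- kernels, so a nowhere-zero spanning kernel vector of one graph is carried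
-- to a spanning kernel vector of the other (lemma `transfer`), and one checks
-- directly that it stays nowhere zero.  The only subtle point is the entry
-- (1 - ρ)·x(v) of ψ(x) at v: it is nonzero because ρ = 1 is impossible in a
-- nut graph (row v of A(G) would force x(u_1) = 0).
module Submission where

open import Defs renaming (sym to adj-sym; irrefl to adj-irrefl)
open import Data.Nat using (ℕ; zero; suc) renaming (_+_ to _+ℕ_)
open import Data.Fin using (Fin; zero; suc; splitAt; _≟_; _↑ˡ_; _↑ʳ_)
open import Data.Fin.Properties using (splitAt-↑ˡ; splitAt-↑ʳ; splitAt⁻¹-↑ˡ; splitAt⁻¹-↑ʳ; suc-injective)
open import Data.Bool using (true; false; _∧_; not)
open import Data.Bool.Properties using (∧-zeroʳ; ∧-identityʳ)
open import Data.Sum using (_⊎_; inj₁; inj₂)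
open import Data.Product using (Σ; _×_; _,_; proj₁; proj₂)
open import Data.Vec.Functional using (updateAt)
open import Data.Vec.Functional.Properties using (updateAt-updates; updateAt-minimal)
open import Data.Rational using (ℚ; 0ℚ; 1ℚ; _+_; _*_; _-_; -_; NonNegative)
open import Data.Rational.Properties
  using (+-*-commutativeRing; heytingCommutativeRing; +-identityˡ; +-identityʳ; +-comm; +-assoc; +-inverseʳ;
         *-zeroˡ; *-zeroʳ; *-identityˡ; *-identityʳ; *-distribˡ-+; neg-injective; positive⁻¹; <-irrefl;
         pos+nonNeg⇒pos; nonNeg+nonNeg⇒nonNeg)
open import Data.Rational.Solver using (module +-*-Solver)
open import Algebra.Bundles using (CommutativeRing)
open import Algebra.Apartness.Properties.HeytingCommutativeRing heytingCommutativeRing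
  using (x#0y#0→xy#0)
import Algebra.Properties.Semiring.Sum (CommutativeRing.semiring +-*-commutativeRing) as Σℚ
open import Relation.Binary.PropositionalEquality
open import Relation.Nullary using (¬_; Dec; yes; no)
open import Relation.Nullary.Decidable using (⌊_⌋; isYes≗does; dec-true; dec-false; ⌊⌋-map′)

open +-*-Solver using (solve; _:+_; _:-_; _:*_; :-_; _:=_)

sumFin≡sum : ∀ n (f : Fin n → ℚ) → sumFin n f ≡ Σℚ.sum f
sumFin≡sum zero    f = refl
sumFin≡sum (suc n) f = cong (f zero +_) (sumFin≡sum n (λ i → f (suc i)))

sum-cong : ∀ n {f g : Fin n → ℚ} → (∀ i → f i ≡ g i) → sumFin n f ≡ sumFin n g
sum-cong n {f} {g} f≗g
  rewrite sumFin≡sum n f | sumFin≡sum n g = Σℚ.sum-cong-≗ f≗g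

sum-+ : ∀ n (f g : Fin n → ℚ) → sumFin n (λ i → f i + g i) ≡ sumFin n f + sumFin n g
sum-+ n f g
  rewrite sumFin≡sum n (λ i → f i + g i) | sumFin≡sum n f | sumFin≡sum n g = Σℚ.∑-distrib-+ f g

sum-*ˡ : ∀ n c (f : Fin n → ℚ) → sumFin n (λ i → c * f i) ≡ c * sumFin n f
sum-*ˡ n c f
  rewrite sumFin≡sum n (λ i → c * f i) | sumFin≡sum n f = sym (Σℚ.*-distribˡ-sum c f)

sum-zero : ∀ n → sumFin n (λ _ → 0ℚ) ≡ 0ℚ
sum-zero n rewrite sumFin≡sum n (λ _ → 0ℚ) = Σℚ.sum-replicate-zero n

sum-swap : ∀ m n (h : Fin m → Fin n → ℚ) →
  sumFin m (λ i → sumFin n (h i)) ≡ sumFin n (λ j → sumFin m (λ i → h i j))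
sum-swap m n h = begin
  sumFin m (λ i → sumFin n (h i))         ≡⟨ sum-cong m (λ i → sumFin≡sum n (h i)) ⟩
  sumFin m (λ i → Σℚ.sum (h i))           ≡⟨ sumFin≡sum m _ ⟩
  Σℚ.sum (λ i → Σℚ.sum (h i))             ≡⟨ Σℚ.∑-comm h ⟩
  Σℚ.sum (λ j → Σℚ.sum (λ i → h i j))     ≡⟨ sumFin≡sum n _ ⟨
  sumFin n (λ j → Σℚ.sum (λ i → h i j))   ≡⟨ sum-cong n (λ j → sumFin≡sum m (λ i → h i j)) ⟨
  sumFin n (λ j → sumFin m (λ i → h i j)) ∎
  where open ≡-Reasoning

sum-zero-weights : ∀ n (f : Fin n → ℚ) → sumFin n (λ i → 0ℚ * f i) ≡ 0ℚ
sum-zero-weights n f = trans (sum-*ˡ n 0ℚ f) (*-zeroˡ (sumFin n f))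

sum-split : ∀ m k (f : Fin (m +ℕ k) → ℚ) →
  sumFin (m +ℕ k) f ≡ sumFin m (λ i → f (i ↑ˡ k)) + sumFin k (λ j → f (m ↑ʳ j))
sum-split zero    k f = sym (+-identityˡ _)
sum-split (suc m) k f = trans (cong (f zero +_) (sum-split m k (λ i → f (suc i))))
                              (sym (+-assoc (f zero) _ _))

⌊⌋-true : ∀ {A : Set} (a? : Dec A) → A → ⌊ a? ⌋ ≡ true
⌊⌋-true a? a = trans (isYes≗does a?) (dec-true a? a)

⌊⌋-false : ∀ {A : Set} (a? : Dec A) → ¬ A → ⌊ a? ⌋ ≡ false
⌊⌋-false a? ¬a = trans (isYes≗does a?) (dec-false a? ¬a)

sum-δ : ∀ n (a : Fin n) (f : Fin n → ℚ) → sumFin n (λ j → entry ⌊ j ≟ a ⌋ * f j) ≡ f a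
sum-δ (suc n) zero    f = begin
  1ℚ * f zero + sumFin n (λ j → 0ℚ * f (suc j)) ≡⟨ cong₂ _+_ (*-identityˡ (f zero)) (sum-zero-weights n (λ j → f (suc j))) ⟩
  f zero + 0ℚ                                    ≡⟨ +-identityʳ _ ⟩
  f zero                                         ∎
  where open ≡-Reasoning
sum-δ (suc n) (suc a) f = begin
  0ℚ * f zero + sumFin n (λ j → entry ⌊ suc j ≟ suc a ⌋ * f (suc j))
    ≡⟨ cong₂ _+_ (*-zeroˡ (f zero)) (sum-cong n (λ j → cong (λ b → entry b * f (suc j)) (suc-≟ j a))) ⟩
  0ℚ + sumFin n (λ j → entry ⌊ j ≟ a ⌋ * f (suc j))
    ≡⟨ +-identityˡ _ ⟩
  sumFin n (λ j → entry ⌊ j ≟ a ⌋ * f (suc j))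
    ≡⟨ sum-δ n a (λ j → f (suc j)) ⟩
  f (suc a) ∎
  where
  open ≡-Reasoning
  suc-≟ : ∀ {n} (j a : Fin n) → ⌊ suc j ≟ suc a ⌋ ≡ ⌊ j ≟ a ⌋
  suc-≟ j a = ⌊⌋-map′ (cong suc) suc-injective (j ≟ a)

≟-sym : ∀ {n} (i j : Fin n) → ⌊ i ≟ j ⌋ ≡ ⌊ j ≟ i ⌋
≟-sym i j with j ≟ i
... | yes refl = ⌊⌋-true (i ≟ i) refl
... | no j≢i   = ⌊⌋-false (i ≟ j) (λ i≡j → j≢i (sym i≡j))

sumExcept : ∀ {n} → (Fin n → ℚ) → Fin n → ℚ
sumExcept {n} f i = sumFin n (λ j → entry (not ⌊ i ≟ j ⌋) * f j)

sumExcept-+ : ∀ n (f : Fin n → ℚ) i → sumExcept f i + f i ≡ sumFin n f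
sumExcept-+ n f i = begin
  sumExcept f i + f i
    ≡⟨ cong (sumExcept f i +_) (sym (trans (sum-cong n (λ j → cong (λ b → entry b * f j) (≟-sym i j))) (sum-δ n i f))) ⟩
  sumExcept f i + sumFin n (λ j → entry ⌊ i ≟ j ⌋ * f j)
    ≡⟨ sum-+ n _ _ ⟨
  sumFin n (λ j → entry (not ⌊ i ≟ j ⌋) * f j + entry ⌊ i ≟ j ⌋ * f j)
    ≡⟨ sum-cong n (λ j → complementary ⌊ i ≟ j ⌋ (f j)) ⟩
  sumFin n f ∎
  where
  open ≡-Reasoning
  complementary : ∀ b x → entry (not b) * x + entry b * x ≡ x
  complementary true  x = trans (cong₂ _+_ (*-zeroˡ x) (*-identityˡ x)) (+-identityˡ x)
  complementary false x = trans (cong₂ _+_ (*-identityˡ x) (*-zeroˡ x)) (+-identityʳ x)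

rearrange : ∀ {a r b s : ℚ} → a + r ≡ 0ℚ → r + b ≡ s → b ≡ s + a
rearrange {a} {r} {b} {s} a+r≡0 r+b≡s = begin
  b                      ≡⟨ solve 3 (λ a r b → b := ((r :+ b) :+ a) :- (a :+ r)) refl a r b ⟩
  (r + b + a) - (a + r)  ≡⟨ cong₂ (λ t d → (t + a) - d) r+b≡s a+r≡0 ⟩
  (s + a) - 0ℚ           ≡⟨ +-identityʳ (s + a) ⟩
  s + a                  ∎
  where open ≡-Reasoning

copies : ℕ → ℚ → ℚ
copies m c = sumFin m (λ _ → c)

copies-factor : ∀ m c → copies m c ≡ c * copies m 1ℚ
copies-factor m c = trans (sum-cong m (λ _ → sym (*-identityʳ c))) (sum-*ˡ m c (λ _ → 1ℚ))

copies-one-nonNegative : ∀ m → NonNegative (copies m 1ℚ)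
copies-one-nonNegative zero    = _
copies-one-nonNegative (suc m) = nonNeg+nonNeg⇒nonNeg 1ℚ (copies m 1ℚ) {{copies-one-nonNegative m}}

copies-nonzero : ∀ m c → c ≢ 0ℚ → copies (suc m) c ≢ 0ℚ
copies-nonzero m c c≢0 = subst (_≢ 0ℚ) (sym (copies-factor (suc m) c)) (x#0y#0→xy#0 c≢0 m+1≢0)
  where
  m+1≢0 : copies (suc m) 1ℚ ≢ 0ℚ
  m+1≢0 m+1≡0 = <-irrefl (sym m+1≡0)
    (positive⁻¹ _ {{pos+nonNeg⇒pos 1ℚ (copies m 1ℚ) {{copies-one-nonNegative m}}}})

-- If m nowhere-zero rationals sum to zero, then m ≠ 1; hence (1 - m)·c ≠ 0
-- for every c ≠ 0.
leftover-nonzero : ∀ m (xs : Fin m → ℚ) c → c ≢ 0ℚ → (∀ i → xs i ≢ 0ℚ) → sumFin m xs ≡ 0ℚ →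
  c - copies m c ≢ 0ℚ
leftover-nonzero zero          xs c c≢0 _     _   c-0≡0 = c≢0 (trans (sym (+-identityʳ c)) c-0≡0)
leftover-nonzero (suc zero)    xs c _   xs≢0  Σ≡0 _     = xs≢0 zero (trans (sym (+-identityʳ (xs zero))) Σ≡0)
leftover-nonzero (suc (suc m)) xs c c≢0 _     _   e     =
  copies-nonzero m c c≢0 (neg-injective (trans (difference c (copies (suc m) c)) e))
  where
  difference : ∀ c s → - s ≡ c - (c + s)
  difference = solve 2 (λ c s → :- s := c :- (c :+ s)) refl

-- If p_1 = … = p_m = Σ p + a with a and all p_i nonzero, then Σ p + a ≠ 0:
-- it is a itself when m = 0, and p_1 otherwise.
shifted-sum-nonzero : ∀ m (p : Fin m → ℚ) a → a ≢ 0ℚ → (∀ i → p i ≢ 0ℚ) →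
  (∀ i → p i ≡ sumFin m p + a) → sumFin m p + a ≢ 0ℚ
shifted-sum-nonzero zero    p a a≢0 _   _      = subst (_≢ 0ℚ) (sym (+-identityˡ a)) a≢0
shifted-sum-nonzero (suc m) p a _   p≢0 p≡Σ+a = subst (_≢ 0ℚ) (p≡Σ+a zero) (p≢0 zero)

-- A graph is a nut graph
-- exactly when it has one (for a nut graph, any kernel vector spans the
-- kernel, and a zero entry would give a non-core vertex).
record FullKernelVector {n} (A : Adj n) (x : Fin n → ℚ) : Set where
  field
    inKernel    : InKernel A x
    nowhereZero : ∀ i → x i ≢ 0ℚ
    spans       : ∀ y → InKernel A y → Σ ℚ λ c → ∀ j → y j ≡ c * x j
open FullKernelVector

nut⇒full : ∀ {n} {A : Adj n} → IsNut A → Σ (Fin n → ℚ) (FullKernelVector A)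
nut⇒full ((_ , core) , (x , x∈ker , _ , x-spans)) =
  x , record { inKernel = x∈ker ; nowhereZero = nowhereZero′ ; spans = x-spans }
  where
  nowhereZero′ : ∀ i → x i ≢ 0ℚ
  nowhereZero′ i xi≡0 with core i
  ... | y , y∈ker , yi≢0 with x-spans y y∈ker
  ...   | c , y≡cx = yi≢0 (trans (y≡cx i) (trans (cong (c *_) xi≡0) (*-zeroʳ c)))

full⇒nut : ∀ {n} {A : Adj n} → Fin n → Σ (Fin n → ℚ) (FullKernelVector A) → IsNut A
full⇒nut i₀ (x , full) =
  ((x , inKernel full , (i₀ , nowhereZero full i₀)) , λ i → x , inKernel full , nowhereZero full i) ,
  (x , inKernel full , (i₀ , nowhereZero full i₀) , spans full)

Homogeneous : ∀ {m n} → ((Fin m → ℚ) → Fin n → ℚ) → Set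
Homogeneous f = ∀ c x x′ → (∀ i → x′ i ≡ c * x i) → ∀ j → f x′ j ≡ c * f x j

record KernelSurjection {m n} (A : Adj m) (B : Adj n) : Set where
  field
    forward     : (Fin m → ℚ) → Fin n → ℚ
    backward    : (Fin n → ℚ) → Fin m → ℚ
    forward-ker  : ∀ x → InKernel A x → InKernel B (forward x)
    backward-ker : ∀ y → InKernel B y → InKernel A (backward y)
    section     : ∀ y → InKernel B y → ∀ j → forward (backward y) j ≡ y j
    homogeneous : Homogeneous forward

transfer : ∀ {m n} {A : Adj m} {B : Adj n} (S : KernelSurjection A B) {x : Fin m → ℚ} →
  FullKernelVector A x → (∀ j → KernelSurjection.forward S x j ≢ 0ℚ) →
  FullKernelVector B (KernelSurjection.forward S x)
transfer {B = B} S {x} full fx≢0 = record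
  { inKernel = forward-ker x (inKernel full) ; nowhereZero = fx≢0 ; spans = spans′ }
  where
  open KernelSurjection S
  spans′ : ∀ y → InKernel B y → Σ ℚ λ c → ∀ j → y j ≡ c * forward x j
  spans′ y y∈ker with spans full (backward y) (backward-ker y y∈ker)
  ... | c , gy≡cx = c , λ j → trans (sym (section y y∈ker j)) (homogeneous c x (backward y) gy≡cx j)

pattern old x = inj₁ x
pattern pv i  = inj₂ (inj₁ i)
pattern qv i  = inj₂ (inj₂ i)

module Fowler {n ρ} (G : Graph n) (v : Fin n) (u : Fin ρ → Fin n) (enum : IsNeighbourEnum G v u) where

  u-injective : ∀ {i j} → u i ≡ u j → i ≡ j
  u-injective = proj₁ enum

  u-onto : ∀ w → adj G v w ≡ true → Σ (Fin ρ) λ i → u i ≡ w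
  u-onto = proj₁ (proj₂ enum)

  u-adjacent : ∀ i → adj G v (u i) ≡ true
  u-adjacent = proj₂ (proj₂ enum)

  u≢v : ∀ i → u i ≢ v
  u≢v i uᵢ≡v with trans (sym (u-adjacent i)) (trans (cong (adj G v) uᵢ≡v) (adj-irrefl G v))
  ... | ()

  neighbour-weights : ∀ w c → sumFin ρ (λ i → entry ⌊ w ≟ u i ⌋ * c) ≡ entry (adj G v w) * c
  neighbour-weights w c with adj G v w in v~w
  ... | true with u-onto w v~w
  ...   | i₀ , uᵢ₀≡w = begin
    sumFin ρ (λ i → entry ⌊ w ≟ u i ⌋ * c) ≡⟨ sum-cong ρ (λ i → cong (λ b → entry b * c) (hits i)) ⟩
    sumFin ρ (λ i → entry ⌊ i ≟ i₀ ⌋ * c)  ≡⟨ sum-δ ρ i₀ (λ _ → c) ⟩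
    c                                      ≡⟨ *-identityˡ c ⟨
    1ℚ * c                                 ∎
    where
    open ≡-Reasoning
    hits : ∀ i → ⌊ w ≟ u i ⌋ ≡ ⌊ i ≟ i₀ ⌋
    hits i with i ≟ i₀
    ... | yes refl = ⌊⌋-true (w ≟ u i) (sym uᵢ₀≡w)
    ... | no i≢i₀  = ⌊⌋-false (w ≟ u i) (λ w≡uᵢ → i≢i₀ (u-injective (trans (sym w≡uᵢ) (sym uᵢ₀≡w))))
  neighbour-weights w c | false =
    trans (sum-cong ρ (λ i → cong (λ b → entry b * c) (⌊⌋-false (w ≟ u i) (misses i))))
          (trans (sum-zero-weights ρ (λ _ → c)) (sym (*-zeroˡ c)))
    where
    misses : ∀ i → w ≢ u i
    misses i refl with trans (sym (u-adjacent i)) v~w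
    ... | ()

  neighbour-sum : ∀ (g : Fin n → ℚ) → sumFin n (λ x → entry (adj G v x) * g x) ≡ sumFin ρ (λ i → g (u i))
  neighbour-sum g = begin
    sumFin n (λ x → entry (adj G v x) * g x)
      ≡⟨ sum-cong n (λ x → neighbour-weights x (g x)) ⟨
    sumFin n (λ x → sumFin ρ (λ i → entry ⌊ x ≟ u i ⌋ * g x))
      ≡⟨ sum-swap n ρ (λ x i → entry ⌊ x ≟ u i ⌋ * g x) ⟩
    sumFin ρ (λ i → sumFin n (λ x → entry ⌊ x ≟ u i ⌋ * g x))
      ≡⟨ sum-cong ρ (λ i → sum-δ n (u i) g) ⟩
    sumFin ρ (λ i → g (u i)) ∎
    where open ≡-Reasoning

  offV : Fin n → (Fin n → ℚ) → ℚ
  offV w y = sumFin n (λ j → entry (adj G w j ∧ not ⌊ j ≟ v ⌋) * y j)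

  row-split : ∀ (x y : Fin n → ℚ) → (∀ j → j ≢ v → x j ≡ y j) → ∀ w →
    sumFin n (λ j → entry (adj G w j) * x j) ≡ offV w y + entry (adj G w v) * x v
  row-split x y x≈y w = begin
    sumFin n (λ j → entry (adj G w j) * x j)
      ≡⟨ sum-cong n entrywise ⟩
    sumFin n (λ j → entry (adj G w j ∧ not ⌊ j ≟ v ⌋) * y j + entry ⌊ j ≟ v ⌋ * atV)
      ≡⟨ sum-+ n _ _ ⟩
    offV w y + sumFin n (λ j → entry ⌊ j ≟ v ⌋ * atV)
      ≡⟨ cong (offV w y +_) (sum-δ n v (λ _ → atV)) ⟩
    offV w y + atV ∎
    where
    open ≡-Reasoning
    atV = entry (adj G w v) * x v
    entrywise : ∀ j → entry (adj G w j) * x j ≡ entry (adj G w j ∧ not ⌊ j ≟ v ⌋) * y j + entry ⌊ j ≟ v ⌋ * atV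
    entrywise j with j ≟ v
    ... | yes refl = sym (begin
      entry (adj G w v ∧ false) * y v + 1ℚ * atV ≡⟨ cong (λ b → entry b * y v + 1ℚ * atV) (∧-zeroʳ (adj G w v)) ⟩
      0ℚ * y v + 1ℚ * atV                         ≡⟨ cong₂ _+_ (*-zeroˡ (y v)) (*-identityˡ atV) ⟩
      0ℚ + atV                                    ≡⟨ +-identityˡ atV ⟩
      atV                                         ∎)
    ... | no j≢v = begin
      entry (adj G w j) * x j                      ≡⟨ cong₂ (λ b t → entry b * t) (sym (∧-identityʳ (adj G w j))) (x≈y j j≢v) ⟩
      entry (adj G w j ∧ true) * y j               ≡⟨ +-identityʳ _ ⟨
      entry (adj G w j ∧ true) * y j + 0ℚ          ≡⟨ cong (entry (adj G w j ∧ true) * y j +_) (*-zeroˡ atV) ⟨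
      entry (adj G w j ∧ true) * y j + 0ℚ * atV    ∎

  V : Set
  V = Fin n ⊎ (Fin ρ ⊎ Fin ρ)

  N : ℕ
  N = n +ℕ (ρ +ℕ ρ)

  join3 : V → Fin N
  join3 (old x) = x ↑ˡ (ρ +ℕ ρ)
  join3 (pv i)  = n ↑ʳ (i ↑ˡ ρ)
  join3 (qv i)  = n ↑ʳ (ρ ↑ʳ i)

  split3-join3 : ∀ s → split3 n ρ (join3 s) ≡ s
  split3-join3 (old x) rewrite splitAt-↑ˡ n x (ρ +ℕ ρ) = refl
  split3-join3 (pv i)  rewrite splitAt-↑ʳ n (ρ +ℕ ρ) (i ↑ˡ ρ) | splitAt-↑ˡ ρ i ρ = refl
  split3-join3 (qv i)  rewrite splitAt-↑ʳ n (ρ +ℕ ρ) (ρ ↑ʳ i) | splitAt-↑ʳ ρ ρ i = refl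

  join3-split3 : ∀ l → join3 (split3 n ρ l) ≡ l
  join3-split3 l with splitAt n l in first
  ... | inj₁ x = splitAt⁻¹-↑ˡ first
  ... | inj₂ k with splitAt ρ k in second
  ...   | inj₁ i = trans (cong (n ↑ʳ_) (splitAt⁻¹-↑ˡ second)) (splitAt⁻¹-↑ʳ first)
  ...   | inj₂ i = trans (cong (n ↑ʳ_) (splitAt⁻¹-↑ʳ second)) (splitAt⁻¹-↑ʳ first)

  olds : (V → ℚ) → Fin n → ℚ
  olds b x = b (old x)

  ps qs : (V → ℚ) → Fin ρ → ℚ
  ps b i = b (pv i)
  qs b i = b (qv i)

  sumV : (V → ℚ) → ℚ
  sumV f = sumFin n (olds f) + (sumFin ρ (ps f) + sumFin ρ (qs f))

  sumV-cong : ∀ {f g : V → ℚ} → (∀ s → f s ≡ g s) → sumV f ≡ sumV g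
  sumV-cong f≗g = cong₂ _+_ (sum-cong n (λ x → f≗g (old x)))
                            (cong₂ _+_ (sum-cong ρ (λ i → f≗g (pv i))) (sum-cong ρ (λ i → f≗g (qv i))))

  sum-join3 : ∀ (f : Fin N → ℚ) → sumFin N f ≡ sumV (λ s → f (join3 s))
  sum-join3 f = trans (sum-split n (ρ +ℕ ρ) f) (cong (sumFin n (λ x → f (x ↑ˡ (ρ +ℕ ρ))) +_) (sum-split ρ ρ _))

  rowSum : V → (V → ℚ) → ℚ
  rowSum a b = sumV (λ s → entry (fowlerAdj⊎ G v u a s) * b s)

  row-fowler : ∀ k (z : Fin N → ℚ) →
    sumFin N (λ l → entry (fowler G v u k l) * z l) ≡ rowSum (split3 n ρ k) (λ s → z (join3 s))
  row-fowler k z = trans (sum-join3 _)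
    (sumV-cong (λ s → cong (λ a → entry (fowlerAdj⊎ G v u (split3 n ρ k) a) * z (join3 s)) (split3-join3 s)))

  rowSum-old : ∀ w → w ≢ v → ∀ b →
    rowSum (old w) b ≡ offV w (olds b) + sumFin ρ (λ i → entry ⌊ w ≟ u i ⌋ * ps b i)
  rowSum-old w w≢v b = cong₂ _+_
    (sum-cong n (λ x → cong (λ c → entry (adj G w x ∧ not c ∧ not ⌊ x ≟ v ⌋) * b (old x)) w≠v))
    (trans (cong (sumFin ρ (λ i → entry ⌊ w ≟ u i ⌋ * ps b i) +_)
                 (trans (sum-cong ρ (λ i → cong (λ c → entry c * b (qv i)) w≠v)) (sum-zero-weights ρ (qs b))))
           (+-identityʳ _))
    where
    w≠v : ⌊ w ≟ v ⌋ ≡ false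
    w≠v = ⌊⌋-false (w ≟ v) w≢v

  rowSum-v : ∀ b → rowSum (old v) b ≡ sumFin ρ (qs b)
  rowSum-v b = begin
    rowSum (old v) b
      ≡⟨ cong₂ _+_ (trans (sum-cong n olds-vanish) (sum-zero n))
                   (cong₂ _+_ (trans (sum-cong ρ ps-vanish) (sum-zero ρ)) (sum-cong ρ qs-kept)) ⟩
    0ℚ + (0ℚ + sumFin ρ (qs b))
      ≡⟨ trans (+-identityˡ _) (+-identityˡ _) ⟩
    sumFin ρ (qs b) ∎
    where
    open ≡-Reasoning
    v=v : ⌊ v ≟ v ⌋ ≡ true
    v=v = ⌊⌋-true (v ≟ v) refl
    olds-vanish : ∀ x → entry (adj G v x ∧ not ⌊ v ≟ v ⌋ ∧ not ⌊ x ≟ v ⌋) * b (old x) ≡ 0ℚ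
    olds-vanish x rewrite v=v | ∧-zeroʳ (adj G v x) = *-zeroˡ (b (old x))
    ps-vanish : ∀ i → entry ⌊ v ≟ u i ⌋ * b (pv i) ≡ 0ℚ
    ps-vanish i rewrite ⌊⌋-false (v ≟ u i) (λ v≡uᵢ → u≢v i (sym v≡uᵢ)) = *-zeroˡ (b (pv i))
    qs-kept : ∀ i → entry ⌊ v ≟ v ⌋ * b (qv i) ≡ b (qv i)
    qs-kept i rewrite v=v = *-identityˡ (b (qv i))

  rowSum-p : ∀ i b → rowSum (pv i) b ≡ olds b (u i) + sumExcept (qs b) i
  rowSum-p i b = cong₂ _+_ (sum-δ n (u i) (olds b))
    (trans (cong (_+ sumExcept (qs b) i) (sum-zero-weights ρ (ps b))) (+-identityˡ _))

  rowSum-q : ∀ i b → rowSum (qv i) b ≡ olds b v + sumExcept (ps b) i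
  rowSum-q i b = cong₂ _+_ (sum-δ n v (olds b))
    (trans (cong (sumExcept (ps b) i +_) (sum-zero-weights ρ (qs b))) (+-identityʳ _))

  record KernelEquations (b : V → ℚ) : Set where
    field
      at-old : ∀ w → w ≢ v → offV w (olds b) + sumFin ρ (λ i → entry ⌊ w ≟ u i ⌋ * ps b i) ≡ 0ℚ
      at-v   : sumFin ρ (qs b) ≡ 0ℚ
      at-p   : ∀ i → olds b (u i) + sumExcept (qs b) i ≡ 0ℚ
      at-q   : ∀ i → olds b v + sumExcept (ps b) i ≡ 0ℚ
  open KernelEquations

  rows⇒equations : ∀ {b} → (∀ a → rowSum a b ≡ 0ℚ) → KernelEquations b
  rows⇒equations {b} rows = record
    { at-old = λ w w≢v → trans (sym (rowSum-old w w≢v b)) (rows (old w))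
    ; at-v   = trans (sym (rowSum-v b)) (rows (old v))
    ; at-p   = λ i → trans (sym (rowSum-p i b)) (rows (pv i))
    ; at-q   = λ i → trans (sym (rowSum-q i b)) (rows (qv i)) }

  equations⇒rows : ∀ {b} → KernelEquations b → ∀ a → rowSum a b ≡ 0ℚ
  equations⇒rows {b} E (old w) = by-cases (w ≟ v)
    where
    by-cases : Dec (w ≡ v) → rowSum (old w) b ≡ 0ℚ
    by-cases (yes refl) = trans (rowSum-v b) (at-v E)
    by-cases (no w≢v)   = trans (rowSum-old w w≢v b) (at-old E w w≢v)
  equations⇒rows {b} E (pv i) = trans (rowSum-p i b) (at-p E i)
  equations⇒rows {b} E (qv i) = trans (rowSum-q i b) (at-q E i)

  kernel⇒equations : ∀ z → InKernel (fowler G v u) z → KernelEquations (λ s → z (join3 s))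
  kernel⇒equations z z∈ker = rows⇒equations λ a →
    subst (λ a′ → rowSum a′ (λ s → z (join3 s)) ≡ 0ℚ) (split3-join3 a) (trans (sym (row-fowler (join3 a) z)) (z∈ker (join3 a)))

  equations⇒kernel : ∀ b → KernelEquations b → InKernel (fowler G v u) (λ l → b (split3 n ρ l))
  equations⇒kernel b E k = begin
    sumFin N (λ l → entry (fowler G v u k l) * b (split3 n ρ l))
      ≡⟨ row-fowler k _ ⟩
    rowSum (split3 n ρ k) (λ s → b (split3 n ρ (join3 s)))
      ≡⟨ sumV-cong (λ s → cong (λ t → entry (fowlerAdj⊎ G v u (split3 n ρ k) s) * b t) (split3-join3 s)) ⟩
    rowSum (split3 n ρ k) b
      ≡⟨ equations⇒rows E (split3 n ρ k) ⟩
    0ℚ ∎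
    where open ≡-Reasoning

  q-solved : ∀ {b} → KernelEquations b → ∀ i → qs b i ≡ olds b (u i)
  q-solved {b} E i = begin
    qs b i                          ≡⟨ rearrange (at-p E i) (sumExcept-+ ρ (qs b) i) ⟩
    sumFin ρ (qs b) + olds b (u i)  ≡⟨ cong (_+ olds b (u i)) (at-v E) ⟩
    0ℚ + olds b (u i)               ≡⟨ +-identityˡ _ ⟩
    olds b (u i)                    ∎
    where open ≡-Reasoning

  p-constant : ∀ {b} → KernelEquations b → ∀ i → ps b i ≡ sumFin ρ (ps b) + olds b v
  p-constant {b} E i = rearrange (at-q E i) (sumExcept-+ ρ (ps b) i)

  toG : (V → ℚ) → Fin n → ℚ
  toG b = updateAt (olds b) v (sumFin ρ (ps b) +_)

  toG-v : ∀ b → toG b v ≡ sumFin ρ (ps b) + olds b v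
  toG-v b = updateAt-updates v (olds b)

  toG-off : ∀ b w → w ≢ v → toG b w ≡ olds b w
  toG-off b w w≢v = updateAt-minimal w v (olds b) w≢v

  toV : (Fin n → ℚ) → V → ℚ
  toV x (old w) = updateAt x v (λ a → a - copies ρ a) w
  toV x (pv i)  = x v
  toV x (qv i)  = x (u i)

  toV-v : ∀ x → toV x (old v) ≡ x v - copies ρ (x v)
  toV-v x = updateAt-updates v x

  toV-off : ∀ x w → w ≢ v → toV x (old w) ≡ x w
  toV-off x w w≢v = updateAt-minimal w v x w≢v

  -- φ maps solutions of the kernel equations into ker A(G): row v of A(G) is
  -- the equation Σ q = 0, and the other rows are the old-vertex equations.
  toG-kernel : ∀ {b} → KernelEquations b → InKernel (adj G) (toG b)
  toG-kernel {b} E w = by-cases (w ≟ v)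
    where
    open ≡-Reasoning
    by-cases : Dec (w ≡ v) → sumFin n (λ j → entry (adj G w j) * toG b j) ≡ 0ℚ
    by-cases (yes refl) = begin
      sumFin n (λ j → entry (adj G v j) * toG b j) ≡⟨ neighbour-sum (toG b) ⟩
      sumFin ρ (λ i → toG b (u i))                 ≡⟨ sum-cong ρ (λ i → trans (toG-off b (u i) (u≢v i)) (sym (q-solved E i))) ⟩
      sumFin ρ (qs b)                              ≡⟨ at-v E ⟩
      0ℚ                                           ∎
    by-cases (no w≢v) = begin
      sumFin n (λ j → entry (adj G w j) * toG b j)
        ≡⟨ row-split (toG b) (olds b) (toG-off b) w ⟩
      offV w (olds b) + entry (adj G w v) * toG b v
        ≡⟨ cong (offV w (olds b) +_) v-entry ⟩
      offV w (olds b) + sumFin ρ (λ i → entry ⌊ w ≟ u i ⌋ * ps b i)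
        ≡⟨ at-old E w w≢v ⟩
      0ℚ ∎
      where
      v-entry : entry (adj G w v) * toG b v ≡ sumFin ρ (λ i → entry ⌊ w ≟ u i ⌋ * ps b i)
      v-entry = begin
        entry (adj G w v) * toG b v                         ≡⟨ cong (λ e → entry e * toG b v) (adj-sym G w v) ⟩
        entry (adj G v w) * toG b v                         ≡⟨ neighbour-weights w (toG b v) ⟨
        sumFin ρ (λ i → entry ⌊ w ≟ u i ⌋ * toG b v)        ≡⟨ sum-cong ρ (λ i → cong (entry ⌊ w ≟ u i ⌋ *_)
                                                                 (trans (toG-v b) (sym (p-constant E i)))) ⟩
        sumFin ρ (λ i → entry ⌊ w ≟ u i ⌋ * ps b i)          ∎

  toV-kernel : ∀ {x} → InKernel (adj G) x → KernelEquations (toV x)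
  toV-kernel {x} x∈ker = record { at-old = at-old′ ; at-v = at-v′ ; at-p = at-p′ ; at-q = at-q′ }
    where
    open ≡-Reasoning
    at-v′ : sumFin ρ (λ i → x (u i)) ≡ 0ℚ
    at-v′ = trans (sym (neighbour-sum x)) (x∈ker v)
    at-old′ : ∀ w → w ≢ v → offV w (olds (toV x)) + sumFin ρ (λ i → entry ⌊ w ≟ u i ⌋ * x v) ≡ 0ℚ
    at-old′ w w≢v = begin
      offV w (olds (toV x)) + sumFin ρ (λ i → entry ⌊ w ≟ u i ⌋ * x v)
        ≡⟨ cong (offV w (olds (toV x)) +_) (trans (neighbour-weights w (x v)) (cong (λ e → entry e * x v) (adj-sym G v w))) ⟩
      offV w (olds (toV x)) + entry (adj G w v) * x v
        ≡⟨ row-split x (olds (toV x)) (λ j j≢v → sym (toV-off x j j≢v)) w ⟨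
      sumFin n (λ j → entry (adj G w j) * x j)
        ≡⟨ x∈ker w ⟩
      0ℚ ∎
    at-p′ : ∀ i → toV x (old (u i)) + sumExcept (λ j → x (u j)) i ≡ 0ℚ
    at-p′ i = begin
      toV x (old (u i)) + sumExcept (λ j → x (u j)) i  ≡⟨ cong (_+ sumExcept (λ j → x (u j)) i) (toV-off x (u i) (u≢v i)) ⟩
      x (u i) + sumExcept (λ j → x (u j)) i            ≡⟨ +-comm (x (u i)) _ ⟩
      sumExcept (λ j → x (u j)) i + x (u i)            ≡⟨ sumExcept-+ ρ (λ j → x (u j)) i ⟩
      sumFin ρ (λ j → x (u j))                         ≡⟨ at-v′ ⟩
      0ℚ                                               ∎
    at-q′ : ∀ i → toV x (old v) + sumExcept (λ _ → x v) i ≡ 0ℚ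
    at-q′ i = begin
      toV x (old v) + sumExcept (λ _ → x v) i
        ≡⟨ cong (_+ sumExcept (λ _ → x v) i) (toV-v x) ⟩
      x v - copies ρ (x v) + sumExcept (λ _ → x v) i
        ≡⟨ cong (λ t → x v - t + sumExcept (λ _ → x v) i) (sumExcept-+ ρ (λ _ → x v) i) ⟨
      x v - (sumExcept (λ _ → x v) i + x v) + sumExcept (λ _ → x v) i
        ≡⟨ cancels (x v) (sumExcept (λ _ → x v) i) ⟩
      0ℚ ∎
      where
      cancels : ∀ a e → a - (e + a) + e ≡ 0ℚ
      cancels a e = trans (solve 2 (λ a e → a :- (e :+ a) :+ e := e :- e) refl a e) (+-inverseʳ e)

  toG-toV : ∀ x j → toG (toV x) j ≡ x j
  toG-toV x j = by-cases (j ≟ v)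
    where
    by-cases : Dec (j ≡ v) → toG (toV x) j ≡ x j
    by-cases (yes refl) = begin
      toG (toV x) v                         ≡⟨ toG-v (toV x) ⟩
      copies ρ (x v) + toV x (old v)        ≡⟨ cong (copies ρ (x v) +_) (toV-v x) ⟩
      copies ρ (x v) + (x v - copies ρ (x v)) ≡⟨ solve 2 (λ s a → s :+ (a :- s) := a) refl (copies ρ (x v)) (x v) ⟩
      x v                                   ∎
      where open ≡-Reasoning
    by-cases (no j≢v) = trans (toG-off (toV x) j j≢v) (toV-off x j j≢v)

  toV-toG : ∀ {b} → KernelEquations b → ∀ s → toV (toG b) s ≡ b s
  toV-toG {b} E (old w) = by-cases (w ≟ v)
    where
    by-cases : Dec (w ≡ v) → toV (toG b) (old w) ≡ b (old w)
    by-cases (yes refl) = begin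
      toV (toG b) (old v)                                 ≡⟨ toV-v (toG b) ⟩
      toG b v - copies ρ (toG b v)                        ≡⟨ cong (λ t → toG b v - t) (sum-cong ρ (λ i → trans (toG-v b) (sym (p-constant E i)))) ⟩
      toG b v - sumFin ρ (ps b)                           ≡⟨ cong (_- sumFin ρ (ps b)) (toG-v b) ⟩
      sumFin ρ (ps b) + olds b v - sumFin ρ (ps b)        ≡⟨ solve 2 (λ s y → s :+ y :- s := y) refl (sumFin ρ (ps b)) (olds b v) ⟩
      b (old v)                                           ∎
      where open ≡-Reasoning
    by-cases (no w≢v) = trans (toV-off (toG b) w w≢v) (toG-off b w w≢v)
  toV-toG {b} E (pv i) = trans (toG-v b) (sym (p-constant E i))
  toV-toG {b} E (qv i) = trans (toG-off b (u i) (u≢v i)) (sym (q-solved E i))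

  toG-homogeneous : ∀ c {b b′ : V → ℚ} → (∀ s → b′ s ≡ c * b s) → ∀ j → toG b′ j ≡ c * toG b j
  toG-homogeneous c {b} {b′} b′≡cb j = by-cases (j ≟ v)
    where
    by-cases : Dec (j ≡ v) → toG b′ j ≡ c * toG b j
    by-cases (yes refl) = begin
      toG b′ v                                   ≡⟨ toG-v b′ ⟩
      sumFin ρ (ps b′) + olds b′ v               ≡⟨ cong₂ _+_ (sum-cong ρ (λ i → b′≡cb (pv i))) (b′≡cb (old v)) ⟩
      sumFin ρ (λ i → c * ps b i) + c * olds b v ≡⟨ cong (_+ c * olds b v) (sum-*ˡ ρ c (ps b)) ⟩
      c * sumFin ρ (ps b) + c * olds b v         ≡⟨ *-distribˡ-+ c _ _ ⟨
      c * (sumFin ρ (ps b) + olds b v)           ≡⟨ cong (c *_) (toG-v b) ⟨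
      c * toG b v                                ∎
      where open ≡-Reasoning
    by-cases (no j≢v) = trans (toG-off b′ j j≢v) (trans (b′≡cb (old j)) (cong (c *_) (sym (toG-off b j j≢v))))

  toV-homogeneous : ∀ c {x x′ : Fin n → ℚ} → (∀ i → x′ i ≡ c * x i) → ∀ s → toV x′ s ≡ c * toV x s
  toV-homogeneous c {x} {x′} x′≡cx (old w) = by-cases (w ≟ v)
    where
    by-cases : Dec (w ≡ v) → toV x′ (old w) ≡ c * toV x (old w)
    by-cases (yes refl) = begin
      toV x′ (old v)                         ≡⟨ toV-v x′ ⟩
      x′ v - copies ρ (x′ v)                 ≡⟨ cong (λ a → a - copies ρ a) (x′≡cx v) ⟩
      c * x v - copies ρ (c * x v)           ≡⟨ cong (λ t → c * x v - t) (sum-*ˡ ρ c (λ _ → x v)) ⟩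
      c * x v - c * copies ρ (x v)           ≡⟨ solve 3 (λ c a s → c :* a :- c :* s := c :* (a :- s)) refl c (x v) (copies ρ (x v)) ⟩
      c * (x v - copies ρ (x v))             ≡⟨ cong (c *_) (toV-v x) ⟨
      c * toV x (old v)                      ∎
      where open ≡-Reasoning
    by-cases (no w≢v) = trans (toV-off x′ w w≢v) (trans (x′≡cx w) (cong (c *_) (sym (toV-off x w w≢v))))
  toV-homogeneous c x′≡cx (pv i) = x′≡cx v
  toV-homogeneous c x′≡cx (qv i) = x′≡cx (u i)

  ψ : (Fin n → ℚ) → Fin N → ℚ
  ψ x l = toV x (split3 n ρ l)

  φ : (Fin N → ℚ) → Fin n → ℚ
  φ z = toG (λ s → z (join3 s))

  G→F : KernelSurjection (adj G) (fowler G v u)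
  G→F = record
    { forward      = ψ
    ; backward     = φ
    ; forward-ker  = λ x x∈ker → equations⇒kernel (toV x) (toV-kernel x∈ker)
    ; backward-ker = λ z z∈ker → toG-kernel (kernel⇒equations z z∈ker)
    ; section      = λ z z∈ker l →
        trans (toV-toG (kernel⇒equations z z∈ker) (split3 n ρ l)) (cong z (join3-split3 l))
    ; homogeneous  = λ c x x′ x′≡cx l → toV-homogeneous c x′≡cx (split3 n ρ l) }

  F→G : KernelSurjection (fowler G v u) (adj G)
  F→G = record
    { forward      = φ
    ; backward     = ψ
    ; forward-ker  = λ z z∈ker → toG-kernel (kernel⇒equations z z∈ker)
    ; backward-ker = λ x x∈ker → equations⇒kernel (toV x) (toV-kernel x∈ker)
    ; section      = λ x _ j → trans (toG-cong (λ s → cong (toV x) (split3-join3 s)) j) (toG-toV x j)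
    ; homogeneous  = λ c z z′ z′≡cz → toG-homogeneous c (λ s → z′≡cz (join3 s)) }
    where
    toG-cong : ∀ {b b′} → (∀ s → b′ s ≡ b s) → ∀ j → toG b′ j ≡ toG b j
    toG-cong {b} {b′} b′≡b j =
      trans (toG-homogeneous 1ℚ {b} {b′} (λ s → trans (b′≡b s) (sym (*-identityˡ (b s)))) j) (*-identityˡ (toG b j))

  -- ψ keeps a full kernel vector of G nowhere zero: its entry (1 - ρ)·x(v)
  -- at v is nonzero since the ρ nonzero entries x(u_i) sum to zero (row v).
  ψ-nowhereZero : ∀ {x} → FullKernelVector (adj G) x → ∀ l → ψ x l ≢ 0ℚ
  ψ-nowhereZero {x} full l = on-blocks (split3 n ρ l)
    where
    x≢0 = nowhereZero full
    on-blocks : ∀ s → toV x s ≢ 0ℚ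
    on-blocks (old w) with w ≟ v
    ... | yes refl = subst (_≢ 0ℚ) (sym (toV-v x))
                       (leftover-nonzero ρ (λ i → x (u i)) (x v) (x≢0 v) (λ i → x≢0 (u i))
                                          (trans (sym (neighbour-sum x)) (inKernel full v)))
    ... | no w≢v   = subst (_≢ 0ℚ) (sym (toV-off x w w≢v)) (x≢0 w)
    on-blocks (pv i) = x≢0 v
    on-blocks (qv i) = x≢0 (u i)

  -- φ keeps a full kernel vector of F(G,v) nowhere zero: at v it takes the
  -- common value of the p-entries (or y(v) when ρ = 0).
  φ-nowhereZero : ∀ {z} → FullKernelVector (fowler G v u) z → ∀ j → φ z j ≢ 0ℚ
  φ-nowhereZero {z} full j with j ≟ v
  ... | yes refl = subst (_≢ 0ℚ) (sym (toG-v b))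
                     (shifted-sum-nonzero ρ (ps b) (olds b v) (z≢0 (old v)) (λ i → z≢0 (pv i))
                                          (p-constant (kernel⇒equations z (inKernel full))))
    where
    b = λ s → z (join3 s)
    z≢0 = λ s → nowhereZero full (join3 s)
  ... | no j≢v   = subst (_≢ 0ℚ) (sym (toG-off (λ s → z (join3 s)) j j≢v)) (nowhereZero full (join3 (old j)))

theorem4 : ∀ {n ρ} (G : Graph n) (v : Fin n) (u : Fin ρ → Fin n)
           → IsNeighbourEnum G v u
           → (IsNut (adj G) → IsNut (fowler G v u)) × (IsNut (fowler G v u) → IsNut (adj G))
theorem4 G v u enum = G-nut⇒F-nut , F-nut⇒G-nut
  where
  open Fowler G v u enum

  G-nut⇒F-nut : IsNut (adj G) → IsNut (fowler G v u)
  G-nut⇒F-nut nut with nut⇒full nut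
  ... | x , full = full⇒nut (join3 (old v)) (ψ x , transfer G→F full (ψ-nowhereZero full))

  F-nut⇒G-nut : IsNut (fowler G v u) → IsNut (adj G)
  F-nut⇒G-nut nut with nut⇒full nut
  ... | z , full = full⇒nut v (φ z , transfer F→G full (φ-nowhereZero full))
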